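{- For all $s\in Act^*$, all $m,n\in Mon_F$ and every verdict $v\in\{\mathit{end},\mathit{yes},\mathit{no}\}$: $m+n\xRightarrow{s}v$ if and only if $m\xRightarrow{s}v$ or $n\xRightarrow{s}v$.
   Context: Fix a set $Act$ of visible actions, a symbol $\tau\notin Act$, and a countably infinite set $Var$ of variables disjoint from $Act\cup\{\tau\}$. Monitors $Mon_F$: $m,n ::= v \mid a.m \mid m+n \mid x$ ($a\in Act$, $x\in Var$), verdicts $v ::= \mathit{end}\mid \mathit{yes}\mid \mathit{no}$. Transitions: for $\alpha\in Act\cup\{\tau\}$, $\xrightarrow{\alpha}$ is the least relation with $a.m\xrightarrow{a}m$; if $m\xrightarrow{\alpha}m'$ then $m+n\xrightarrow{\alpha}m'$ and $n+m\xrightarrow{\alpha}m'$; and $v\xrightarrow{\alpha}v$ for every verdict $v$ and every $\alpha$ (variables have no transitions). Weak transitions: $m\xRightarrow{\varepsilon}m'$ iff $m(\xrightarrow{\tau})^*m'$; $m\xRightarrow{a}m'$ iff $m\xRightarrow{\varepsilon}m_1\xrightarrow{a}m_2\xRightarrow{\varepsilon}m'$ for some $m_1,m_2$; $m\xRightarrow{as'}m'$ ($s'\neq\varepsilon$) iff $m\xRightarrow{a}m_1\xRightarrow{s'}m'$ for some $m_1$. -}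

module Defs where

open import Data.List using (List; []; _∷_)
open import Data.Product using (∃-syntax; _×_)
open import Relation.Binary.Construct.Closure.ReflexiveTransitive using (Star)

module Monitors (Act : Set) (Var : Set) where

  data Verdict : Set where
    end yes no : Verdict

  data Mon : Set where
    verd : Verdict → Mon
    _·_  : Act → Mon → Mon
    _⊕_  : Mon → Mon → Mon
    var  : Var → Mon

  data Label : Set where
    act : Act → Label
    τ   : Label

  data _—[_]→_ : Mon → Label → Mon → Set where
    prefix : ∀ {a m} → (a · m) —[ act a ]→ m
    sumL   : ∀ {m n m' α} → m —[ α ]→ m' → (m ⊕ n) —[ α ]→ m'
    sumR   : ∀ {m n m' α} → m —[ α ]→ m' → (n ⊕ m) —[ α ]→ m'
    verdict : ∀ {v α} → verd v —[ α ]→ verd v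

  _—τ→_ : Mon → Mon → Set
  m —τ→ m' = m —[ τ ]→ m'

  _=ε⇒_ : Mon → Mon → Set
  _=ε⇒_ = Star _—τ→_

  _=[_]⇒₁_ : Mon → Act → Mon → Set
  m =[ a ]⇒₁ m' = ∃[ m₁ ] ∃[ m₂ ] (m =ε⇒ m₁ × m₁ —[ act a ]→ m₂ × m₂ =ε⇒ m')

  _=[_]⇒_ : Mon → List Act → Mon → Set
  m =[ [] ]⇒ m' = m =ε⇒ m'
  m =[ a ∷ [] ]⇒ m' = m =[ a ]⇒₁ m'
  m =[ a ∷ s@(_ ∷ _) ]⇒ m' = ∃[ m₁ ] (m =[ a ]⇒₁ m₁ × m₁ =[ s ]⇒ m')

-- The strong steps of m ⊕ n are exactly those of m and of n. Since m ⊕ n is not a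
-- verdict, a weak transition from it to a verdict begins with a strong step, which comes
-- from one summand; the remainder no longer involves the sum. Conversely, a weak
-- transition of a summand to a verdict can always be made to begin with a strong step
-- (a verdict reaches itself by a τ-loop), and the sum can take that step.
module Submission where

open import Defs
open import Data.List using (List; []; _∷_)
open import Data.Sum using (_⊎_; inj₁; inj₂; [_,_])
import Data.Sum as Sum
open import Data.Product using (_,_)
open import Function.Bundles using (_⇔_; mk⇔)
open import Relation.Binary.Construct.Closure.ReflexiveTransitive using (ε; _◅_)

module WeakSum (Act Var : Set) where
  open Monitors Act Var

  private
    variable
      k m n x : Mon
      α : Label
      a : Act
      v : Verdict

  infix 4 _⊆→_

  _⊆→_ : Mon → Mon → Set
  m ⊆→ k = ∀ {α x} → m —[ α ]→ x → k —[ α ]→ x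

  ⊆→-⊕ˡ : m ⊆→ m ⊕ n
  ⊆→-⊕ˡ = sumL

  ⊆→-⊕ʳ : n ⊆→ m ⊕ n
  ⊆→-⊕ʳ = sumR

  ⊕-step⁻ : (m ⊕ n) —[ α ]→ x → (m —[ α ]→ x) ⊎ (n —[ α ]→ x)
  ⊕-step⁻ (sumL t) = inj₁ t
  ⊕-step⁻ (sumR t) = inj₂ t

  ⊆→-τ*-verd : m ⊆→ k → m =ε⇒ verd v → k =ε⇒ verd v
  ⊆→-τ*-verd m⊆k ε        = m⊆k verdict ◅ ε
  ⊆→-τ*-verd m⊆k (t ◅ ts) = m⊆k t ◅ ts

  ⊆→-weak₁ : m ⊆→ k → m =[ a ]⇒₁ x → k =[ a ]⇒₁ x
  ⊆→-weak₁ m⊆k (_ , _ , ε      , t , us) = _ , _ , ε , m⊆k t , us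
  ⊆→-weak₁ m⊆k (_ , _ , u ◅ ts , t , us) = _ , _ , m⊆k u ◅ ts , t , us

  ⊆→-weak-verd : m ⊆→ k → ∀ s → m =[ s ]⇒ verd v → k =[ s ]⇒ verd v
  ⊆→-weak-verd m⊆k []          p           = ⊆→-τ*-verd m⊆k p
  ⊆→-weak-verd m⊆k (_ ∷ [])    p           = ⊆→-weak₁ m⊆k p
  ⊆→-weak-verd m⊆k (_ ∷ _ ∷ _) (_ , p , q) = _ , ⊆→-weak₁ m⊆k p , q

  ⊕-τ*-verd⁻ : (m ⊕ n) =ε⇒ verd v → (m =ε⇒ verd v) ⊎ (n =ε⇒ verd v)
  ⊕-τ*-verd⁻ (t ◅ ts) = Sum.map (_◅ ts) (_◅ ts) (⊕-step⁻ t)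

  ⊕-weak₁⁻ : (m ⊕ n) =[ a ]⇒₁ x → (m =[ a ]⇒₁ x) ⊎ (n =[ a ]⇒₁ x)
  ⊕-weak₁⁻ (_ , _ , ε , t , us) =
    Sum.map (λ t′ → _ , _ , ε , t′ , us) (λ t′ → _ , _ , ε , t′ , us) (⊕-step⁻ t)
  ⊕-weak₁⁻ (_ , _ , u ◅ ts , t , us) =
    Sum.map (λ u′ → _ , _ , u′ ◅ ts , t , us) (λ u′ → _ , _ , u′ ◅ ts , t , us) (⊕-step⁻ u)

  ⊕-weak-verd⁻ : ∀ s → (m ⊕ n) =[ s ]⇒ verd v → (m =[ s ]⇒ verd v) ⊎ (n =[ s ]⇒ verd v)
  ⊕-weak-verd⁻ []          p           = ⊕-τ*-verd⁻ p
  ⊕-weak-verd⁻ (_ ∷ [])    p           = ⊕-weak₁⁻ p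
  ⊕-weak-verd⁻ (_ ∷ _ ∷ _) (_ , p , q) = Sum.map (λ p′ → _ , p′ , q) (λ p′ → _ , p′ , q) (⊕-weak₁⁻ p)

lemma1 : (Act Var : Set) → let open Monitors Act Var in
    (s : List Act) (m n : Mon) (v : Verdict) →
      ((m ⊕ n) =[ s ]⇒ verd v) ⇔ ((m =[ s ]⇒ verd v) ⊎ (n =[ s ]⇒ verd v))
lemma1 Act Var s m n v = mk⇔
  (⊕-weak-verd⁻ s)
  [ ⊆→-weak-verd ⊆→-⊕ˡ s , ⊆→-weak-verd ⊆→-⊕ʳ s ]
  where open WeakSum Act Var
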